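{- Let $n\ge0$, $\tau\in\mathfrak S_n$ and $\sigma:=\mathrm{DW}^{\rm loc}(\tau)$. Then $(\mathrm{FIX},\mathrm{DEZ})\,\tau=(\mathrm{PIX},\mathrm{IDES})\,\sigma$ and $(\mathrm{fix},\mathrm{maz})\,\tau=(\mathrm{pix},\mathrm{imaj})\,\sigma$.
   Context: Permutations are words $\sigma(1)\cdots\sigma(n)$. For a word $x_1\cdots x_n$ of nonnegative integers, $\mathrm{DES}=\{i\le n-1:x_i>x_{i+1}\}$, $\mathrm{maj}=\sum_{i\in\mathrm{DES}}i$. $\mathrm{FIX}\,\sigma=\{i:\sigma(i)=i\}$, $\mathrm{fix}=\#\mathrm{FIX}$; $\mathrm{IDES}\,\sigma=\mathrm{DES}\,\sigma^{ -1}$, $\mathrm{imaj}\,\sigma=\sum_{i\in\mathrm{IDES}\,\sigma}i$. Let $j_1<\dots<j_m$ be the non-fixed points of $\sigma$ and $\mathrm{red}$ the increasing bijection $\{j_1,\dots,j_m\}\to\{1,\dots,m\}$. $\mathrm{Der}\,\sigma=\mathrm{red}\,\sigma(j_1)\cdots\mathrm{red}\,\sigma(j_m)\in\mathfrak S_m$ (a derangement; $\sigma$ is determined by $(\mathrm{FIX}\,\sigma,\mathrm{Der}\,\sigma)$). $\mathrm{ZDer}(\sigma)=x_1\cdots x_n$ with $x_i=0$ if $\sigma(i)=i$, $x_i=\mathrm{red}\,\sigma(i)$ otherwise; $\mathrm{DEZ}\,\sigma=\mathrm{DES}\,\mathrm{ZDer}(\sigma)$, $\mathrm{maz}\,\sigma=\mathrm{maj}\,\mathrm{ZDer}(\sigma)$.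 A word $y_1\cdots y_m$ with distinct letters is a desarrangement if $y_1>\dots>y_{2k}<y_{2k+1}$ for some $k\ge1$ (convention $y_{m+1}=\infty$). Each $\sigma$ factors uniquely as $\sigma^p\sigma^d$ with $\sigma^p$ increasing and $\sigma^d$ the longest right factor that is a desarrangement. $\mathrm{PIX}\,\sigma$ = set of letters of $\sigma^p$, $\mathrm{pix}=\#\mathrm{PIX}$; $\mathrm{Desar}\,\sigma\in\mathfrak S_m$ is $\sigma^d$ reduced order-preservingly to $\{1,\dots,m\}$. For every $A\subseteq[n]$ and desarrangement $\delta\in\mathfrak S_{n-|A|}$ there is a unique $\sigma$ with $(\mathrm{PIX}\,\sigma,\mathrm{Desar}\,\sigma)=(A,\delta)$. $D_m$ = derangements in $\mathfrak S_m$, $K_m$ = desarrangements in $\mathfrak S_m$. $\mathrm{DW}:D_m\to K_m$ is the Désarménien–Wachs bijection, satisfying $\mathrm{IDES}(\mathrm{DW}(\delta))=\mathrm{DES}\,\delta$ for all $\delta\in D_m$. $\mathrm{DW}^{\rm loc}(\tau)$ is the permutation $\sigma$ with $(\mathrm{PIX}\,\sigma,\mathrm{Desar}\,\sigma)=(\mathrm{FIX}\,\tau,\mathrm{DW}(\mathrm{Der}\,\tau))$. -}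

module Defs where

open import Data.Nat using (ℕ; zero; suc; _+_; _*_; _≤_; _<_; _>_; _≡ᵇ_; _<ᵇ_; _≟_; _≤?_)
open import Data.Bool using (Bool; true; false; if_then_else_)
open import Data.List using (List; []; _∷_; _++_; [_]; map; filter; length; upTo; zip)
open import Data.Nat.ListAction using (sum)
open import Data.List.Relation.Binary.Permutation.Propositional using (_↭_)
open import Data.List.Relation.Unary.Linked using (Linked)
open import Data.Product using (Σ; _×_; _,_; proj₁; proj₂; ∃; ∃-syntax)
open import Data.Sum using (_⊎_)
open import Relation.Nullary using (¬?)
open import Relation.Binary.PropositionalEquality using (_≡_)

-- Words are lists of natural numbers; positions are 1-based.
Word : Set
Word = List ℕ

range : ℕ → List ℕ
range n = map suc (upTo n)

-- σ ∈ 𝔖_n, written as the word σ(1)⋯σ(n)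
IsPerm : ℕ → Word → Set
IsPerm n w = w ↭ range n

DESfrom : ℕ → Word → List ℕ
DESfrom i [] = []
DESfrom i (x ∷ []) = []
DESfrom i (x ∷ y ∷ w) =
  if y <ᵇ x then i ∷ DESfrom (suc i) (y ∷ w) else DESfrom (suc i) (y ∷ w)

DES : Word → List ℕ
DES = DESfrom 1

maj : Word → ℕ
maj w = sum (DES w)

enum : Word → List (ℕ × ℕ)
enum w = zip (range (length w)) w

FIX : Word → List ℕ
FIX σ = map proj₁ (filter (λ p → proj₁ p ≟ proj₂ p) (enum σ))

fix : Word → ℕ
fix σ = length (FIX σ)

posOf : ℕ → Word → ℕ
posOf j [] = 0
posOf j (x ∷ w) = if x ≡ᵇ j then 1 else suc (posOf j w)

inv : Word → Word
inv σ = map (λ j → posOf j σ) (range (length σ))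

IDES : Word → List ℕ
IDES σ = DES (inv σ)

imaj : Word → ℕ
imaj σ = sum (IDES σ)

NF : Word → List ℕ
NF σ = map proj₁ (filter (λ p → ¬? (proj₁ p ≟ proj₂ p)) (enum σ))

red : List ℕ → ℕ → ℕ
red S v = length (filter (λ s → s ≤? v) S)

ZDer : Word → Word
ZDer σ = map (λ p → if proj₁ p ≡ᵇ proj₂ p then 0 else red (NF σ) (proj₂ p)) (enum σ)

DEZ : Word → List ℕ
DEZ σ = DES (ZDer σ)

maz : Word → ℕ
maz σ = maj (ZDer σ)

Der : Word → Word
Der σ = map (λ p → red (NF σ) (proj₂ p)) (filter (λ p → ¬? (proj₁ p ≟ proj₂ p)) (enum σ))

-- order-preserving reduction of a word with distinct letters to {1,…,m}
std : Word → Word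
std w = map (red w) w

-- Desarrangement: y₁ > ⋯ > y_{2k} < y_{2k+1} for some k ≥ 1 (y_{m+1} = ∞).
-- Convention: the empty word is also a desarrangement (K₀ = {ε}).
IsDesarr : Word → Set
IsDesarr w =
  (w ≡ [])
  ⊎ (Σ ℕ λ k → Σ Word λ a → Σ ℕ λ z → Σ Word λ b →
       (1 ≤ k) × (length a + 1 ≡ 2 * k) × (w ≡ a ++ [ z ] ++ b)
       × Linked _>_ (a ++ [ z ])
       × ((b ≡ []) ⊎ (Σ ℕ λ y → Σ Word λ b' → (b ≡ y ∷ b') × (z < y))))

IsFactor : Word → Word → Word → Set
IsFactor σ p d = (σ ≡ p ++ d) × Linked _<_ p × IsDesarr d

-- σ = σ^p σ^d : σ^d is the longest such right factor.
-- Then PIX σ = letters of p (listed increasingly, as p is increasing), pix σ = length p,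
-- Desar σ = std d.
IsPixFactor : Word → Word → Word → Set
IsPixFactor σ p d = IsFactor σ p d × (∀ p' d' → IsFactor σ p' d' → length d' ≤ length d)

IsDerangement : ℕ → Word → Set
IsDerangement m δ = IsPerm m δ × (FIX δ ≡ [])

IsDesarrangementPerm : ℕ → Word → Set
IsDesarrangementPerm m δ = IsPerm m δ × IsDesarr δ

IsDW : (ℕ → Word → Word) → Set
IsDW DW =
  (∀ m δ → IsDerangement m δ → IsDesarrangementPerm m (DW m δ) × (IDES (DW m δ) ≡ DES δ))
  × (∀ m δ δ' → IsDerangement m δ → IsDerangement m δ' → DW m δ ≡ DW m δ' → δ ≡ δ')
  × (∀ m κ → IsDesarrangementPerm m κ → Σ Word λ δ → IsDerangement m δ × (DW m δ ≡ κ))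

-- σ = DW^loc(τ): (PIX σ, Desar σ) = (FIX τ, DW(Der τ))
IsDWloc : (ℕ → Word → Word) → Word → Word → Set
IsDWloc DW τ σ =
  Σ Word λ p → Σ Word λ d →
    IsPixFactor σ p d × (p ≡ FIX τ) × (std d ≡ DW (length d) (Der τ))

-- σ is FIX τ (increasing) followed by a word d on the moved points of τ, so σ⁻¹ increases on the
-- fixed points and sends every fixed point before every moved point, while ZDer τ is 0 exactly at
-- the fixed points. Hence whenever i or i+1 is fixed, i is a descent of ZDer τ iff it is one of σ⁻¹
-- (both happen exactly when i is moved and i+1 fixed). When both are moved they are consecutive
-- moved points j_r < j_(r+1): ZDer τ reads Der τ at r and r+1 there, and σ⁻¹ compares the positions
-- of r and r+1 in std d = DW (Der τ), so this case is the defining property IDES ∘ DW = DES.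
-- The factor σ^p is unique because σ^d is the longest desarrangement suffix, so σ^p = FIX τ.

module Submission where

open import Defs
open import Data.Nat using (ℕ; zero; suc; _+_; _≤_; _<_; _≤ᵇ_; _≡ᵇ_; _<ᵇ_; z≤n; s≤s)
open import Data.Nat.Properties
open import Data.Bool using (Bool; true; false; if_then_else_; T)
open import Data.List using (List; []; _∷_; _++_; map; filter; length; zip; applyUpTo)
open import Data.List.Properties using (∷-injective; length-++; length-map; length-applyUpTo; length-filter; map-upTo; map-cong; map-cong-local; map-∘; map-++)
open import Data.List.Membership.Propositional using (_∈_; _∉_)
open import Data.List.Membership.Propositional.Properties using (∈-map⁺; ∈-map⁻; ∈-filter⁺; ∈-filter⁻)
open import Data.List.Relation.Unary.Any using (here; there)
open import Data.List.Relation.Unary.All as All using (All; []; _∷_)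
open import Data.List.Relation.Unary.AllPairs using (AllPairs; []; _∷_)
import Data.List.Relation.Unary.AllPairs.Properties as AllPairs
import Data.List.Relation.Unary.All.Properties as AllProps
open import Data.List.Relation.Binary.Permutation.Propositional using (_↭_; prep; ↭-refl; ↭-sym; ↭-trans; module PermutationReasoning)
open import Data.List.Relation.Binary.Permutation.Propositional.Properties using (↭-length; filter-↭; shift; drop-∷; map⁺; ∈-resp-↭)
open import Data.Product using (∃; _×_; _,_; proj₁; proj₂)
open import Data.Nat.ListAction using (sum)
open import Data.Sum using (_⊎_; inj₁; inj₂; [_,_]′)
open import Data.Empty using (⊥-elim)
open import Function using (_∘_; Equivalence)
open import Data.Bool.Properties using (T-≡)
open import Relation.Nullary using (¬_; ¬?; Dec; yes; no)
open import Relation.Unary using (Decidable)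
open import Relation.Binary.Definitions using (tri<; tri≈; tri>)
open import Relation.Binary.PropositionalEquality

lookupᵈ : {A : Set} → A → List A → ℕ → A
lookupᵈ a []       k       = a
lookupᵈ a (x ∷ xs) zero    = x
lookupᵈ a (x ∷ xs) (suc k) = lookupᵈ a xs k

-- 0-based (w ! k is the letter at position suc k), and 0 out of range.
infixl 9 _!_
_!_ : Word → ℕ → ℕ
_!_ = lookupᵈ 0

lookupᵈ-map : {A B : Set} (f : A → B) {a : A} {b : B} (xs : List A) {k : ℕ} →
  k < length xs → lookupᵈ b (map f xs) k ≡ f (lookupᵈ a xs k)
lookupᵈ-map f (x ∷ xs) {zero}  _         = refl
lookupᵈ-map f (x ∷ xs) {suc k} (s≤s k<n) = lookupᵈ-map f xs k<n

lookupᵈ-applyUpTo : {A : Set} (a : A) (f : ℕ → A) (n : ℕ) {k : ℕ} → k < n → lookupᵈ a (applyUpTo f n) k ≡ f k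
lookupᵈ-applyUpTo a f (suc n) {zero}  _         = refl
lookupᵈ-applyUpTo a f (suc n) {suc k} (s≤s k<n) = lookupᵈ-applyUpTo a (f ∘ suc) n k<n

lookupᵈ-zip : {A B : Set} (a : A) (b : B) (xs : List A) (ys : List B) →
  length xs ≡ length ys → ∀ k → lookupᵈ (a , b) (zip xs ys) k ≡ (lookupᵈ a xs k , lookupᵈ b ys k)
lookupᵈ-zip a b []       []       _  k       = refl
lookupᵈ-zip a b (x ∷ xs) (y ∷ ys) _  zero    = refl
lookupᵈ-zip a b (x ∷ xs) (y ∷ ys) eq (suc k) = lookupᵈ-zip a b xs ys (suc-injective eq) k

lookupᵈ-∈ : {A : Set} (a : A) (xs : List A) {k : ℕ} → k < length xs → lookupᵈ a xs k ∈ xs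
lookupᵈ-∈ a (x ∷ xs) {zero}  _         = here refl
lookupᵈ-∈ a (x ∷ xs) {suc k} (s≤s k<n) = there (lookupᵈ-∈ a xs k<n)

map-proj₁-zip : {A B : Set} (xs : List A) (ys : List B) → length xs ≡ length ys → map proj₁ (zip xs ys) ≡ xs
map-proj₁-zip []       []       _  = refl
map-proj₁-zip (x ∷ xs) (y ∷ ys) eq = cong (x ∷_) (map-proj₁-zip xs ys (suc-injective eq))

map-proj₂-zip : {A B : Set} (xs : List A) (ys : List B) → length xs ≡ length ys → map proj₂ (zip xs ys) ≡ ys
map-proj₂-zip []       []       _  = refl
map-proj₂-zip (x ∷ xs) (y ∷ ys) eq = cong (y ∷_) (map-proj₂-zip xs ys (suc-injective eq))

range≡applyUpTo : ∀ n → range n ≡ applyUpTo suc n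
range≡applyUpTo = map-upTo suc

length-range : ∀ n → length (range n) ≡ n
length-range n = trans (cong length (range≡applyUpTo n)) (length-applyUpTo suc n)

range-lookup : ∀ n {k} → k < n → range n ! k ≡ suc k
range-lookup n k<n rewrite range≡applyUpTo n = lookupᵈ-applyUpTo 0 suc n k<n

range-increasing : ∀ n → AllPairs _<_ (range n)
range-increasing n rewrite range≡applyUpTo n = AllPairs.applyUpTo⁺₁ suc n (λ i<j _ → s≤s i<j)

length-IsPerm : ∀ {n w} → IsPerm n w → length w ≡ n
length-IsPerm {n} w↭ = trans (↭-length w↭) (length-range n)

∈⇒lookupᵈ : {A : Set} (a : A) {x : A} {xs : List A} → x ∈ xs → ∃ λ k → k < length xs × lookupᵈ a xs k ≡ x
∈⇒lookupᵈ a (here refl) = zero , s≤s z≤n , refl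
∈⇒lookupᵈ a (there x∈) with k , k<n , eq ← ∈⇒lookupᵈ a x∈ = suc k , s≤s k<n , eq

map-proj₁-enum : ∀ w → map proj₁ (enum w) ≡ range (length w)
map-proj₁-enum w = map-proj₁-zip (range (length w)) w (length-range (length w))

map-proj₂-enum : ∀ w → map proj₂ (enum w) ≡ w
map-proj₂-enum w = map-proj₂-zip (range (length w)) w (length-range (length w))

length-enum : ∀ w → length (enum w) ≡ length w
length-enum w = trans (sym (length-map proj₂ (enum w))) (cong length (map-proj₂-enum w))

enum-lookup : ∀ w {k} → k < length w → lookupᵈ (0 , 0) (enum w) k ≡ (suc k , w ! k)
enum-lookup w {k} k<n =
  trans (lookupᵈ-zip 0 0 (range (length w)) w (length-range (length w)) k)
        (cong (_, w ! k) (range-lookup (length w) k<n))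

∈-enum⁺ : ∀ w {k} → k < length w → (suc k , w ! k) ∈ enum w
∈-enum⁺ w {k} k<n =
  subst (_∈ enum w) (enum-lookup w k<n) (lookupᵈ-∈ (0 , 0) (enum w) (subst (k <_) (sym (length-enum w)) k<n))

∈-enum⁻ : ∀ w {q} → q ∈ enum w → ∃ λ k → k < length w × q ≡ (suc k , w ! k)
∈-enum⁻ w q∈ with k , k<n , refl ← ∈⇒lookupᵈ (0 , 0) q∈
  with k<w ← subst (k <_) (length-enum w) k<n = k , k<w , enum-lookup w k<w

enum-increasing : ∀ w → AllPairs (λ q q′ → proj₁ q < proj₁ q′) (enum w)
enum-increasing w =
  AllPairs.map⁻ (subst (AllPairs _<_) (sym (map-proj₁-enum w)) (range-increasing (length w)))

descentAt : Word → ℕ → Bool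
descentAt w k = w ! suc k <ᵇ w ! k

DESfrom-cong : ∀ i (w w′ : Word) → length w ≡ length w′ →
  (∀ k → suc k < length w → descentAt w k ≡ descentAt w′ k) → DESfrom i w ≡ DESfrom i w′
DESfrom-cong i []          []            _  _    = refl
DESfrom-cong i (x ∷ [])    (x′ ∷ [])     _  _    = refl
DESfrom-cong i (x ∷ y ∷ w) (x′ ∷ y′ ∷ w′) eq same
  with ih ← DESfrom-cong (suc i) (y ∷ w) (y′ ∷ w′) (suc-injective eq) (λ k k<n → same (suc k) (s≤s k<n))
  rewrite same 0 (s≤s (s≤s z≤n)) | ih = refl

∈-if-∷ : ∀ (c : Bool) (i : ℕ) {r : List ℕ} {x} → x ∈ (if c then i ∷ r else r) → x ≡ i ⊎ x ∈ r
∈-if-∷ true  i (here x≡i) = inj₁ x≡i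
∈-if-∷ true  i (there x∈) = inj₂ x∈
∈-if-∷ false i x∈         = inj₂ x∈

DESfrom-≥ : ∀ i w {x} → x ∈ DESfrom i w → i ≤ x
DESfrom-≥ i (a ∷ b ∷ w) x∈ =
  [ (λ { refl → ≤-refl }) , (λ x∈′ → ≤-trans (n≤1+n i) (DESfrom-≥ (suc i) (b ∷ w) x∈′)) ]′
  (∈-if-∷ (b <ᵇ a) i x∈)

∈-DESfrom⁺ : ∀ i w k → suc k < length w → descentAt w k ≡ true → i + k ∈ DESfrom i w
∈-DESfrom⁺ i (a ∷ [])    zero    (s≤s ()) _
∈-DESfrom⁺ i (a ∷ b ∷ w) zero    _        des rewrite des = here (+-identityʳ i)
∈-DESfrom⁺ i (a ∷ b ∷ w) (suc k) (s≤s k<n) des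
  with ∈-tail ← subst (_∈ DESfrom (suc i) (b ∷ w)) (sym (+-suc i k)) (∈-DESfrom⁺ (suc i) (b ∷ w) k k<n des)
  with b <ᵇ a
... | true  = there ∈-tail
... | false = ∈-tail

DESfrom-head : ∀ i a b w → i ∈ DESfrom i (a ∷ b ∷ w) → (b <ᵇ a) ≡ true
DESfrom-head i a b w i∈ with b <ᵇ a
... | true  = refl
... | false = ⊥-elim (<-irrefl refl (DESfrom-≥ (suc i) (b ∷ w) i∈))

DESfrom-tail : ∀ i a b w {x} → i < x → x ∈ DESfrom i (a ∷ b ∷ w) → x ∈ DESfrom (suc i) (b ∷ w)
DESfrom-tail i a b w i<x x∈ with b <ᵇ a | x∈
... | true  | here refl = ⊥-elim (<-irrefl refl i<x)
... | true  | there x∈′ = x∈′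
... | false | x∈′       = x∈′

∈-DESfrom⁻ : ∀ i w k → i + k ∈ DESfrom i w → descentAt w k ≡ true
∈-DESfrom⁻ i (a ∷ b ∷ w) zero    i∈   = DESfrom-head i a b w (subst (_∈ DESfrom i (a ∷ b ∷ w)) (+-identityʳ i) i∈)
∈-DESfrom⁻ i (a ∷ b ∷ w) (suc k) i+k∈ =
  ∈-DESfrom⁻ (suc i) (b ∷ w) k
    (DESfrom-tail i a b w (s≤s (m≤m+n i k)) (subst (_∈ DESfrom i (a ∷ b ∷ w)) (+-suc i k) i+k∈))

DESfrom⇒descentAt : ∀ i (w w′ : Word) → DESfrom i w ≡ DESfrom i w′ → length w ≡ length w′ →
  ∀ k → suc k < length w → descentAt w k ≡ descentAt w′ k
DESfrom⇒descentAt i w w′ same eq k k<n with descentAt w k in d | descentAt w′ k in d′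
... | true  | true  = refl
... | false | false = refl
... | true  | false = sym (trans (sym d′)
  (∈-DESfrom⁻ i w′ k (subst (i + k ∈_) same (∈-DESfrom⁺ i w k k<n d))))
... | false | true  = trans (sym d)
  (∈-DESfrom⁻ i w k (subst (i + k ∈_) (sym same) (∈-DESfrom⁺ i w′ k (subst (suc k <_) eq k<n) d′)))

posOf-here : ∀ x w → posOf x (x ∷ w) ≡ 1
posOf-here x w with x ≡ᵇ x in x≡ᵇx
... | true  = refl
... | false = ⊥-elim (subst T x≡ᵇx (≡⇒≡ᵇ x x refl))

posOf-there : ∀ x y w → y ≢ x → posOf x (y ∷ w) ≡ suc (posOf x w)
posOf-there x y w y≢x with y ≡ᵇ x in y≡ᵇx
... | true  = ⊥-elim (y≢x (≡ᵇ⇒≡ y x (subst T (sym y≡ᵇx) _)))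
... | false = refl

posOf-++ˡ : ∀ x p d → x ∈ p → posOf x (p ++ d) ≡ posOf x p
posOf-++ˡ x (y ∷ p) d x∈ with y ≟ x | x∈
... | yes refl | _         = trans (posOf-here x (p ++ d)) (sym (posOf-here x p))
... | no y≢x   | here x≡y  = ⊥-elim (y≢x (sym x≡y))
... | no y≢x   | there x∈′ =
  trans (posOf-there x y (p ++ d) y≢x) (trans (cong suc (posOf-++ˡ x p d x∈′)) (sym (posOf-there x y p y≢x)))

posOf-++ʳ : ∀ x p d → x ∉ p → posOf x (p ++ d) ≡ length p + posOf x d
posOf-++ʳ x []      d _   = refl
posOf-++ʳ x (y ∷ p) d x∉ with y ≟ x
... | yes refl = ⊥-elim (x∉ (here refl))
... | no y≢x   = trans (posOf-there x y (p ++ d) y≢x) (cong suc (posOf-++ʳ x p d (x∉ ∘ there)))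

posOf-positive : ∀ x w → x ∈ w → 1 ≤ posOf x w
posOf-positive x (y ∷ w) _ with y ≡ᵇ x
... | true  = s≤s z≤n
... | false = s≤s z≤n

posOf≤length : ∀ x w → x ∈ w → posOf x w ≤ length w
posOf≤length x (y ∷ w) x∈ with y ≟ x | x∈
... | yes refl | _         = ≤-trans (≤-reflexive (posOf-here x w)) (s≤s z≤n)
... | no y≢x   | here x≡y  = ⊥-elim (y≢x (sym x≡y))
... | no y≢x   | there x∈′ = ≤-trans (≤-reflexive (posOf-there x y w y≢x)) (s≤s (posOf≤length x w x∈′))

posOf-mono-< : ∀ p {x y} → AllPairs _<_ p → x ∈ p → y ∈ p → x < y → posOf x p < posOf y p
posOf-mono-< (z ∷ p) (z< ∷ p<) (here refl) (here refl) x<y = ⊥-elim (<-irrefl refl x<y)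
posOf-mono-< (z ∷ p) {x} {y} (z< ∷ p<) (here refl) (there y∈) x<y =
  subst₂ _<_ (sym (posOf-here x p)) (sym (posOf-there y x p (<⇒≢ x<y))) (s≤s (posOf-positive y p y∈))
posOf-mono-< (z ∷ p) (z< ∷ p<) (there x∈) (here refl) x<y = ⊥-elim (<-asym x<y (All.lookup z< x∈))
posOf-mono-< (z ∷ p) {x} {y} (z< ∷ p<) (there x∈) (there y∈) x<y =
  subst₂ _<_ (sym (posOf-there x z p (<⇒≢ (All.lookup z< x∈)))) (sym (posOf-there y z p (<⇒≢ (All.lookup z< y∈))))
    (s≤s (posOf-mono-< p p< x∈ y∈ x<y))

posOf-map : ∀ (f : ℕ → ℕ) v w → (∀ z → z ∈ w → f z ≡ f v → z ≡ v) → posOf (f v) (map f w) ≡ posOf v w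
posOf-map f v []      _   = refl
posOf-map f v (z ∷ w) inj with z ≟ v
... | yes refl = trans (posOf-here (f z) (map f w)) (sym (posOf-here z w))
... | no z≢v   =
  trans (posOf-there (f v) (f z) (map f w) (z≢v ∘ inj z (here refl)))
    (trans (cong suc (posOf-map f v w (λ z′ z′∈ → inj z′ (there z′∈)))) (sym (posOf-there v z w z≢v)))

length-inv : ∀ w → length (inv w) ≡ length w
length-inv w = trans (length-map _ (range (length w))) (length-range (length w))

inv-lookup : ∀ w {k} → k < length w → inv w ! k ≡ posOf (suc k) w
inv-lookup w {k} k<n =
  trans (lookupᵈ-map (λ j → posOf j w) {a = 0} (range (length w)) (subst (k <_) (sym (length-range (length w))) k<n))
        (cong (λ j → posOf j w) (range-lookup (length w) k<n))

red-∷-≤ : ∀ x S v → x ≤ v → red (x ∷ S) v ≡ suc (red S v)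
red-∷-≤ x S v x≤v with x ≤ᵇ v in x≤ᵇv
... | true  = refl
... | false = ⊥-elim (subst T x≤ᵇv (≤⇒≤ᵇ x≤v))

red-∷-≰ : ∀ x S v → ¬ x ≤ v → red (x ∷ S) v ≡ red S v
red-∷-≰ x S v x≰v with x ≤ᵇ v in x≤ᵇv
... | true  = ⊥-elim (x≰v (≤ᵇ⇒≤ x v (subst T (sym x≤ᵇv) _)))
... | false = refl

red-positive : ∀ S v → v ∈ S → 1 ≤ red S v
red-positive (x ∷ S) v (here refl) rewrite red-∷-≤ x S x ≤-refl = s≤s z≤n
red-positive (x ∷ S) v (there v∈) with x ≤? v
... | yes x≤v rewrite red-∷-≤ x S v x≤v = s≤s z≤n
... | no  x≰v rewrite red-∷-≰ x S v x≰v = red-positive S v v∈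

red≤length : ∀ S v → red S v ≤ length S
red≤length S v = length-filter (λ s → s ≤? v) S

red-mono-≤ : ∀ S {a b} → a ≤ b → red S a ≤ red S b
red-mono-≤ []      a≤b = z≤n
red-mono-≤ (x ∷ S) {a} {b} a≤b with x ≤? a | x ≤? b
... | yes x≤a | yes x≤b rewrite red-∷-≤ x S a x≤a | red-∷-≤ x S b x≤b = s≤s (red-mono-≤ S a≤b)
... | yes x≤a | no  x≰b = ⊥-elim (x≰b (≤-trans x≤a a≤b))
... | no  x≰a | yes x≤b rewrite red-∷-≰ x S a x≰a | red-∷-≤ x S b x≤b = m≤n⇒m≤1+n (red-mono-≤ S a≤b)
... | no  x≰a | no  x≰b rewrite red-∷-≰ x S a x≰a | red-∷-≰ x S b x≰b = red-mono-≤ S a≤b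

red-mono-< : ∀ S {a b} → a < b → b ∈ S → red S a < red S b
red-mono-< (x ∷ S) {a} a<x (here refl)
  rewrite red-∷-≤ x S x ≤-refl | red-∷-≰ x S a (<⇒≱ a<x) = s≤s (red-mono-≤ S (<⇒≤ a<x))
red-mono-< (x ∷ S) {a} {b} a<b (there b∈) with x ≤? a | x ≤? b
... | yes x≤a | yes x≤b rewrite red-∷-≤ x S a x≤a | red-∷-≤ x S b x≤b = s≤s (red-mono-< S a<b b∈)
... | yes x≤a | no  x≰b = ⊥-elim (x≰b (≤-trans x≤a (<⇒≤ a<b)))
... | no  x≰a | yes x≤b rewrite red-∷-≰ x S a x≰a | red-∷-≤ x S b x≤b = m≤n⇒m≤1+n (red-mono-< S a<b b∈)
... | no  x≰a | no  x≰b rewrite red-∷-≰ x S a x≰a | red-∷-≰ x S b x≰b = red-mono-< S a<b b∈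

red-injective : ∀ S {a b} → a ∈ S → b ∈ S → red S a ≡ red S b → a ≡ b
red-injective S {a} {b} a∈ b∈ eq with <-cmp a b
... | tri< a<b _ _ = ⊥-elim (<-irrefl eq (red-mono-< S a<b b∈))
... | tri≈ _ a≡b _ = a≡b
... | tri> _ _ b<a = ⊥-elim (<-irrefl (sym eq) (red-mono-< S b<a a∈))

red-below : ∀ S a → All (a <_) S → red S a ≡ 0
red-below []      a []          = refl
red-below (x ∷ S) a (a<x ∷ a<S) rewrite red-∷-≰ x S a (<⇒≱ a<x) = red-below S a a<S

red-∷-min : ∀ x S → All (x <_) S → red (x ∷ S) x ≡ 1
red-∷-min x S x< = trans (red-∷-≤ x S x ≤-refl) (cong suc (red-below S x x<))

red-suc-∉ : ∀ S i → suc i ∉ S → red S (suc i) ≡ red S i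
red-suc-∉ []      i _ = refl
red-suc-∉ (x ∷ S) i i+1∉ with x ≤? suc i | x ≤? i
... | yes x≤i+1 | yes x≤i rewrite red-∷-≤ x S (suc i) x≤i+1 | red-∷-≤ x S i x≤i =
  cong suc (red-suc-∉ S i (i+1∉ ∘ there))
... | yes x≤i+1 | no  x≰i = ⊥-elim (i+1∉ (here (≤-antisym (≰⇒> x≰i) x≤i+1)))
... | no  x≰i+1 | yes x≤i = ⊥-elim (x≰i+1 (m≤n⇒m≤1+n x≤i))
... | no  x≰i+1 | no  x≰i rewrite red-∷-≰ x S (suc i) x≰i+1 | red-∷-≰ x S i x≰i = red-suc-∉ S i (i+1∉ ∘ there)

red-suc-∈ : ∀ S i → AllPairs _<_ S → suc i ∈ S → red S (suc i) ≡ suc (red S i)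
red-suc-∈ (x ∷ S) i (x< ∷ S<) (here refl)
  rewrite red-∷-≤ x S x ≤-refl | red-∷-≰ x S i (<⇒≱ ≤-refl)
  = cong suc (red-suc-∉ S i (λ x∈ → <-irrefl refl (All.lookup x< x∈)))
red-suc-∈ (x ∷ S) i (x< ∷ S<) (there i+1∈) with x ≤? suc i | x ≤? i
... | yes x≤i+1 | yes x≤i rewrite red-∷-≤ x S (suc i) x≤i+1 | red-∷-≤ x S i x≤i = cong suc (red-suc-∈ S i S< i+1∈)
... | yes x≤i+1 | no  x≰i = ⊥-elim (<-irrefl (sym (≤-antisym (≰⇒> x≰i) x≤i+1)) (All.lookup x< i+1∈))
... | no  x≰i+1 | yes x≤i = ⊥-elim (x≰i+1 (m≤n⇒m≤1+n x≤i))
... | no  x≰i+1 | no  x≰i rewrite red-∷-≰ x S (suc i) x≰i+1 | red-∷-≰ x S i x≰i = red-suc-∈ S i S< i+1∈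

red-↭ : ∀ {S S′} v → S ↭ S′ → red S v ≡ red S′ v
red-↭ v S↭S′ = ↭-length (filter-↭ (λ s → s ≤? v) S↭S′)

map-red-self : ∀ S → AllPairs _<_ S → map (red S) S ≡ range (length S)
map-red-self []      [] = refl
map-red-self (x ∷ S) (x< ∷ S<) = begin
  red (x ∷ S) x ∷ map (red (x ∷ S)) S  ≡⟨ cong₂ _∷_ (trans (red-∷-≤ x S x ≤-refl) (cong suc (red-below S x x<)))
                                                     (map-cong-local (All.map (λ x<y → red-∷-≤ x S _ (<⇒≤ x<y)) x<)) ⟩
  1 ∷ map (suc ∘ red S) S             ≡⟨ cong (1 ∷_) (map-∘ S) ⟩
  1 ∷ map suc (map (red S) S)         ≡⟨ cong (λ r → 1 ∷ map suc r) (map-red-self S S<) ⟩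
  1 ∷ map suc (range (length S))      ≡⟨ cong (λ r → 1 ∷ map suc r) (range≡applyUpTo (length S)) ⟩
  range (suc (length S))              ∎
  where open ≡-Reasoning

<ᵇ-true : ∀ {m n} → m < n → (m <ᵇ n) ≡ true
<ᵇ-true m<n = Equivalence.to T-≡ (<⇒<ᵇ m<n)

<ᵇ-false : ∀ {m n} → n ≤ m → (m <ᵇ n) ≡ false
<ᵇ-false {m} {n} n≤m with m <ᵇ n in m<ᵇn
... | true  = ⊥-elim (<⇒≱ (<ᵇ⇒< m n (subst T (sym m<ᵇn) _)) n≤m)
... | false = refl

+-cancelˡ-<ᵇ : ∀ c x y → (c + x <ᵇ c + y) ≡ (x <ᵇ y)
+-cancelˡ-<ᵇ zero    x y = refl
+-cancelˡ-<ᵇ (suc c) x y = +-cancelˡ-<ᵇ c x y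

if-≡ᵇ-yes : ∀ {A : Set} {a b} (x y : A) → a ≡ b → (if a ≡ᵇ b then x else y) ≡ x
if-≡ᵇ-yes {a = a} {b} x y a≡b with a ≡ᵇ b in a≡ᵇb
... | true  = refl
... | false = ⊥-elim (subst T a≡ᵇb (≡⇒≡ᵇ a b a≡b))

if-≡ᵇ-no : ∀ {A : Set} {a b} (x y : A) → a ≢ b → (if a ≡ᵇ b then x else y) ≡ y
if-≡ᵇ-no {a = a} {b} x y a≢b with a ≡ᵇ b in a≡ᵇb
... | true  = ⊥-elim (a≢b (≡ᵇ⇒≡ a b (subst T (sym a≡ᵇb) _)))
... | false = refl

lookup-by-rank : ∀ (g : ℕ × ℕ → ℕ) F {q} r → AllPairs (λ q q′ → proj₁ q < proj₁ q′) F → q ∈ F →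
  red (map proj₁ F) (proj₁ q) ≡ suc r → map g F ! r ≡ g q
lookup-by-rank g (q ∷ F) zero    q<F         (here refl) _    = refl
lookup-by-rank g (q ∷ F) (suc r) (q< ∷ F<)   (here refl) rank =
  ⊥-elim (0≢1+n (suc-injective (trans (sym (red-∷-min (proj₁ q) (map proj₁ F) (AllProps.map⁺ q<))) rank)))
lookup-by-rank g (q′ ∷ F) {q} r (q′< ∷ F<) (there q∈) rank
  with rank′ ← suc-injective (trans (sym (red-∷-≤ (proj₁ q′) (map proj₁ F) (proj₁ q) (<⇒≤ (All.lookup q′< q∈)))) rank)
  with r
... | zero  = ⊥-elim (<-irrefl (sym rank′) (red-positive (map proj₁ F) (proj₁ q) (∈-map⁺ proj₁ q∈)))
... | suc r = lookup-by-rank g F r F< q∈ rank′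

filter-++-filter-¬-↭ : {A : Set} {P : A → Set} (P? : Decidable P) (xs : List A) →
  filter P? xs ++ filter (¬? ∘ P?) xs ↭ xs
filter-++-filter-¬-↭ P? []       = ↭-refl
filter-++-filter-¬-↭ P? (x ∷ xs) with P? x
... | yes _ = prep x (filter-++-filter-¬-↭ P? xs)
... | no  _ = ↭-trans (shift x _ _) (prep x (filter-++-filter-¬-↭ P? xs))

map-proj₂-filter-≟ : (L : List (ℕ × ℕ)) →
  map proj₂ (filter (λ q → proj₁ q ≟ proj₂ q) L) ≡ map proj₁ (filter (λ q → proj₁ q ≟ proj₂ q) L)
map-proj₂-filter-≟ []      = refl
map-proj₂-filter-≟ ((a , b) ∷ L) with a ≡ᵇ b in a≡ᵇb
... | true  = cong₂ _∷_ (sym (≡ᵇ⇒≡ a b (subst T (sym a≡ᵇb) _))) (map-proj₂-filter-≟ L)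
... | false = map-proj₂-filter-≟ L

filter-≟-≢ : (L : List (ℕ × ℕ)) → (∀ {q} → q ∈ L → proj₁ q ≢ proj₂ q) → filter (λ q → proj₁ q ≟ proj₂ q) L ≡ []
filter-≟-≢ []            _  = refl
filter-≟-≢ ((a , b) ∷ L) ≢L with a ≡ᵇ b in a≡ᵇb
... | true  = ⊥-elim (≢L (here refl) (≡ᵇ⇒≡ a b (subst T (sym a≡ᵇb) _)))
... | false = filter-≟-≢ L (≢L ∘ there)

zip-map-map : {A B C : Set} (f : A → B) (g : A → C) (xs : List A) → zip (map f xs) (map g xs) ≡ map (λ x → f x , g x) xs
zip-map-map f g []       = refl
zip-map-map f g (x ∷ xs) = cong (_ ∷_) (zip-map-map f g xs)

++-cancelˡ-↭ : {A : Set} (xs : List A) {ys zs : List A} → xs ++ ys ↭ xs ++ zs → ys ↭ zs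
++-cancelˡ-↭ []       ys↭zs = ys↭zs
++-cancelˡ-↭ (x ∷ xs) ys↭zs = ++-cancelˡ-↭ xs (drop-∷ ys↭zs)

module MovedPoints {n : ℕ} (τ : Word) (τ-perm : IsPerm n τ) where

  fixedPairs movedPairs : List (ℕ × ℕ)
  fixedPairs = filter (λ q → proj₁ q ≟ proj₂ q) (enum τ)
  movedPairs = filter (λ q → ¬? (proj₁ q ≟ proj₂ q)) (enum τ)

  length-τ : length τ ≡ n
  length-τ = length-IsPerm τ-perm

  FIX-increasing : AllPairs _<_ (FIX τ)
  FIX-increasing = AllPairs.map⁺ (AllPairs.filter⁺ _ (enum-increasing τ))

  movedPairs-increasing : AllPairs (λ q q′ → proj₁ q < proj₁ q′) movedPairs
  movedPairs-increasing = AllPairs.filter⁺ _ (enum-increasing τ)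

  NF-increasing : AllPairs _<_ (NF τ)
  NF-increasing = AllPairs.map⁺ movedPairs-increasing

  FIX++NF↭range : FIX τ ++ NF τ ↭ range n
  FIX++NF↭range = begin
    FIX τ ++ NF τ                         ≡⟨ map-++ proj₁ fixedPairs movedPairs ⟨
    map proj₁ (fixedPairs ++ movedPairs)  ↭⟨ map⁺ proj₁ (filter-++-filter-¬-↭ _ (enum τ)) ⟩
    map proj₁ (enum τ)                    ≡⟨ map-proj₁-enum τ ⟩
    range (length τ)                      ≡⟨ cong range length-τ ⟩
    range n                               ∎
    where open PermutationReasoning

  moved-values↭NF : map proj₂ movedPairs ↭ NF τ
  moved-values↭NF = ++-cancelˡ-↭ (FIX τ) (begin
    FIX τ ++ map proj₂ movedPairs                 ≡⟨ cong (_++ map proj₂ movedPairs) (map-proj₂-filter-≟ (enum τ)) ⟨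
    map proj₂ fixedPairs ++ map proj₂ movedPairs  ≡⟨ map-++ proj₂ fixedPairs movedPairs ⟨
    map proj₂ (fixedPairs ++ movedPairs)          ↭⟨ map⁺ proj₂ (filter-++-filter-¬-↭ _ (enum τ)) ⟩
    map proj₂ (enum τ)                            ≡⟨ map-proj₂-enum τ ⟩
    τ                                             ↭⟨ τ-perm ⟩
    range n                                       ↭⟨ FIX++NF↭range ⟨
    FIX τ ++ NF τ                                 ∎)
    where open PermutationReasoning

  moved-value∈NF : ∀ {q} → q ∈ movedPairs → proj₂ q ∈ NF τ
  moved-value∈NF q∈ = ∈-resp-↭ moved-values↭NF (∈-map⁺ proj₂ q∈)

  Der-perm : Der τ ↭ range (length (NF τ))
  Der-perm = begin
    Der τ                                    ≡⟨ map-∘ movedPairs ⟩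
    map (red (NF τ)) (map proj₂ movedPairs)  ↭⟨ map⁺ (red (NF τ)) moved-values↭NF ⟩
    map (red (NF τ)) (NF τ)                  ≡⟨ map-red-self (NF τ) NF-increasing ⟩
    range (length (NF τ))                    ∎
    where open PermutationReasoning

  Der-FIX : FIX (Der τ) ≡ []
  Der-FIX = begin
    FIX (Der τ)
      ≡⟨ cong (λ r → map proj₁ (filter (λ q → proj₁ q ≟ proj₂ q) (zip r (Der τ)))) positions ⟩
    map proj₁ (filter (λ q → proj₁ q ≟ proj₂ q) (zip (map rank₁ movedPairs) (map rank₂ movedPairs)))
      ≡⟨ cong (map proj₁ ∘ filter (λ q → proj₁ q ≟ proj₂ q)) (zip-map-map rank₁ rank₂ movedPairs) ⟩
    map proj₁ (filter (λ q → proj₁ q ≟ proj₂ q) (map (λ q → rank₁ q , rank₂ q) movedPairs))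
      ≡⟨ cong (map proj₁) (filter-≟-≢ _ no-fixed-rank) ⟩
    []
      ∎
    where
    open ≡-Reasoning
    rank₁ rank₂ : ℕ × ℕ → ℕ
    rank₁ q = red (NF τ) (proj₁ q)
    rank₂ q = red (NF τ) (proj₂ q)
    positions : range (length (Der τ)) ≡ map rank₁ movedPairs
    positions = begin
      range (length (Der τ))           ≡⟨ cong range (trans (length-map rank₂ movedPairs) (sym (length-map proj₁ movedPairs))) ⟩
      range (length (NF τ))            ≡⟨ map-red-self (NF τ) NF-increasing ⟨
      map (red (NF τ)) (NF τ)          ≡⟨ map-∘ movedPairs ⟨
      map rank₁ movedPairs             ∎
    no-fixed-rank : ∀ {q′} → q′ ∈ map (λ q → rank₁ q , rank₂ q) movedPairs → proj₁ q′ ≢ proj₂ q′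
    no-fixed-rank q′∈ rank₁≡rank₂ with q , q∈ , refl ← ∈-map⁻ _ q′∈ =
      proj₂ (∈-filter⁻ (λ q → ¬? (proj₁ q ≟ proj₂ q)) {xs = enum τ} q∈)
        (red-injective (NF τ) (∈-map⁺ proj₁ q∈) (moved-value∈NF q∈) rank₁≡rank₂)

  Der-lookup : ∀ {q} r → q ∈ movedPairs → red (NF τ) (proj₁ q) ≡ suc r → Der τ ! r ≡ red (NF τ) (proj₂ q)
  Der-lookup r = lookup-by-rank (λ q → red (NF τ) (proj₂ q)) movedPairs r movedPairs-increasing

  zEntry : ℕ × ℕ → ℕ
  zEntry q = if proj₁ q ≡ᵇ proj₂ q then 0 else red (NF τ) (proj₂ q)

  ZDer-lookup : ∀ {k} → k < n → ZDer τ ! k ≡ zEntry (suc k , τ ! k)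
  ZDer-lookup {k} k<n = begin
    ZDer τ ! k                           ≡⟨ lookupᵈ-map zEntry (enum τ) (subst (k <_) (sym (trans (length-enum τ) length-τ)) k<n) ⟩
    zEntry (lookupᵈ (0 , 0) (enum τ) k)  ≡⟨ cong zEntry (enum-lookup τ (subst (k <_) (sym length-τ) k<n)) ⟩
    zEntry (suc k , τ ! k)               ∎
    where open ≡-Reasoning

  moved∈movedPairs : ∀ {k} → k < n → suc k ≢ τ ! k → (suc k , τ ! k) ∈ movedPairs
  moved∈movedPairs k<n = ∈-filter⁺ (λ q → ¬? (proj₁ q ≟ proj₂ q)) (∈-enum⁺ τ (subst (_ <_) (sym length-τ) k<n))

  fixed∈FIX : ∀ {k} → k < n → suc k ≡ τ ! k → suc k ∈ FIX τ
  fixed∈FIX k<n fixed = ∈-map⁺ proj₁ (∈-filter⁺ (λ q → proj₁ q ≟ proj₂ q) (∈-enum⁺ τ (subst (_ <_) (sym length-τ) k<n)) fixed)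

  moved∉FIX : ∀ {k} → suc k ≢ τ ! k → suc k ∉ FIX τ
  moved∉FIX moved k+1∈
    with q , q∈ , refl ← ∈-map⁻ proj₁ k+1∈
    with q∈enum , fixed ← ∈-filter⁻ (λ q → proj₁ q ≟ proj₂ q) q∈
    with k′ , _ , refl ← ∈-enum⁻ τ q∈enum = moved fixed

module DWloc (DW : ℕ → Word → Word)
  (IDES-DW : ∀ m δ → IsDerangement m δ → IDES (DW m δ) ≡ DES δ)
  {n : ℕ} (τ σ d : Word) (τ-perm : IsPerm n τ) (σ-perm : IsPerm n σ)
  (σ≡FIX++d : σ ≡ FIX τ ++ d) (std≡DW : std d ≡ DW (length d) (Der τ)) where

  open MovedPoints τ τ-perm

  d↭NF : d ↭ NF τ
  d↭NF = ++-cancelˡ-↭ (FIX τ) (begin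
    FIX τ ++ d     ≡⟨ σ≡FIX++d ⟨
    σ              ↭⟨ σ-perm ⟩
    range n        ↭⟨ FIX++NF↭range ⟨
    FIX τ ++ NF τ  ∎)
    where open PermutationReasoning

  posOf-σ-FIX : ∀ {i} → i ∈ FIX τ → posOf i σ ≡ posOf i (FIX τ)
  posOf-σ-FIX {i} i∈ = trans (cong (posOf i) σ≡FIX++d) (posOf-++ˡ i (FIX τ) d i∈)

  posOf-σ-NF : ∀ {i} → i ∉ FIX τ → posOf i σ ≡ length (FIX τ) + posOf i d
  posOf-σ-NF {i} i∉ = trans (cong (posOf i) σ≡FIX++d) (posOf-++ʳ i (FIX τ) d i∉)

  fixed-before-fixed : ∀ {i j} → i ∈ FIX τ → j ∈ FIX τ → i < j → posOf i σ < posOf j σ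
  fixed-before-fixed i∈ j∈ i<j =
    subst₂ _<_ (sym (posOf-σ-FIX i∈)) (sym (posOf-σ-FIX j∈)) (posOf-mono-< (FIX τ) FIX-increasing i∈ j∈ i<j)

  fixed-before-moved : ∀ {i j} → i ∈ FIX τ → j ∈ NF τ → j ∉ FIX τ → posOf i σ < posOf j σ
  fixed-before-moved {i} {j} i∈ j∈ j∉ = begin-strict
    posOf i σ                     ≡⟨ posOf-σ-FIX i∈ ⟩
    posOf i (FIX τ)               ≤⟨ posOf≤length i (FIX τ) i∈ ⟩
    length (FIX τ)                <⟨ m<m+n (length (FIX τ)) (posOf-positive j d (∈-resp-↭ (↭-sym d↭NF) j∈)) ⟩
    length (FIX τ) + posOf j d    ≡⟨ posOf-σ-NF j∉ ⟨
    posOf j σ                     ∎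
    where open ≤-Reasoning

  IDES-std≡DES-Der : DES (inv (std d)) ≡ DES (Der τ)
  IDES-std≡DES-Der = trans (cong IDES std≡DW)
    (IDES-DW (length d) (Der τ) (subst (λ m → Der τ ↭ range m) (sym (↭-length d↭NF)) Der-perm , Der-FIX))

  posOf-std : ∀ {v} → v ∈ NF τ → posOf (red (NF τ) v) (std d) ≡ posOf v d
  posOf-std {v} v∈ = trans (cong (posOf (red (NF τ) v)) (map-cong (λ x → red-↭ x d↭NF) d))
    (posOf-map (red (NF τ)) v d (λ z z∈ → red-injective (NF τ) (∈-resp-↭ d↭NF z∈) v∈))

  length-inv-std : length (inv (std d)) ≡ length (NF τ)
  length-inv-std = trans (length-inv (std d)) (trans (length-map (red d) d) (↭-length d↭NF))

  inv-std-lookup : ∀ {r} → r < length (NF τ) → inv (std d) ! r ≡ posOf (suc r) (std d)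
  inv-std-lookup {r} r< = inv-lookup (std d) (subst (r <_) (sym (trans (length-map (red d) d) (↭-length d↭NF))) r<)

  descentAt-inv-std : ∀ r → suc r < length (NF τ) → descentAt (inv (std d)) r ≡ descentAt (Der τ) r
  descentAt-inv-std r r+1< = DESfrom⇒descentAt 1 (inv (std d)) (Der τ) IDES-std≡DES-Der
    (trans length-inv-std (sym (trans (↭-length Der-perm) (length-range (length (NF τ))))))
    r (subst (suc r <_) (sym length-inv-std) r+1<)

  -- The moved points suc k and suc (suc k) have consecutive ranks suc r and suc (suc r).
  moved-moved : ∀ {k} → suc k < n → suc k ≢ τ ! k → suc (suc k) ≢ τ ! suc k →
    (red (NF τ) (τ ! suc k) <ᵇ red (NF τ) (τ ! k)) ≡ (posOf (suc (suc k)) σ <ᵇ posOf (suc k) σ)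
  moved-moved {k} k+1<n i-moved i+1-moved
    with red (NF τ) (suc k) in rank-i
       | red-positive (NF τ) (suc k) (∈-map⁺ proj₁ (moved∈movedPairs (<⇒≤ k+1<n) i-moved))
  ... | suc r | _ = begin
    S (τ ! suc k) <ᵇ S (τ ! k)                                   ≡⟨ cong₂ _<ᵇ_ (Der-lookup (suc r) i+1∈ rank-i+1) (Der-lookup r i∈ rank-i) ⟨
    descentAt (Der τ) r                                          ≡⟨ descentAt-inv-std r r+1< ⟨
    descentAt (inv (std d)) r                                    ≡⟨ cong₂ _<ᵇ_ (inv-std-lookup r+1<) (inv-std-lookup (<⇒≤ r+1<)) ⟩
    posOf (suc (suc r)) (std d) <ᵇ posOf (suc r) (std d)         ≡⟨ cong₂ (λ x y → posOf x (std d) <ᵇ posOf y (std d)) rank-i+1 rank-i ⟨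
    posOf (S (suc (suc k))) (std d) <ᵇ posOf (S (suc k)) (std d) ≡⟨ cong₂ _<ᵇ_ (posOf-std (∈-map⁺ proj₁ i+1∈)) (posOf-std (∈-map⁺ proj₁ i∈)) ⟩
    posOf (suc (suc k)) d <ᵇ posOf (suc k) d                     ≡⟨ +-cancelˡ-<ᵇ (length (FIX τ)) _ _ ⟨
    length (FIX τ) + posOf (suc (suc k)) d <ᵇ length (FIX τ) + posOf (suc k) d
      ≡⟨ cong₂ _<ᵇ_ (posOf-σ-NF (moved∉FIX i+1-moved)) (posOf-σ-NF (moved∉FIX i-moved)) ⟨
    posOf (suc (suc k)) σ <ᵇ posOf (suc k) σ                     ∎
    where
    open ≡-Reasoning
    S : ℕ → ℕ
    S = red (NF τ)
    i∈ = moved∈movedPairs (<⇒≤ k+1<n) i-moved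
    i+1∈ = moved∈movedPairs k+1<n i+1-moved
    rank-i+1 : S (suc (suc k)) ≡ suc (suc r)
    rank-i+1 = trans (red-suc-∈ (NF τ) (suc k) NF-increasing (∈-map⁺ proj₁ i+1∈)) (cong suc rank-i)
    r+1< : suc r < length (NF τ)
    r+1< = subst (_≤ length (NF τ)) rank-i+1 (red≤length (NF τ) (suc (suc k)))

  descentAt-ZDer≡descentAt-inv : ∀ k → suc k < n → descentAt (ZDer τ) k ≡ descentAt (inv σ) k
  descentAt-ZDer≡descentAt-inv k k+1<n = begin
    descentAt (ZDer τ) k                                        ≡⟨ cong₂ _<ᵇ_ (ZDer-lookup k+1<n) (ZDer-lookup k<n) ⟩
    zEntry (suc (suc k) , τ ! suc k) <ᵇ zEntry (suc k , τ ! k)  ≡⟨ compare (suc k ≟ τ ! k) (suc (suc k) ≟ τ ! suc k) ⟩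
    posOf (suc (suc k)) σ <ᵇ posOf (suc k) σ                    ≡⟨ cong₂ _<ᵇ_ (inv-lookup σ (k<σ k+1<n)) (inv-lookup σ (k<σ k<n)) ⟨
    descentAt (inv σ) k                                         ∎
    where
    open ≡-Reasoning
    k<n : k < n
    k<n = <⇒≤ k+1<n
    k<σ : ∀ {j} → j < n → j < length σ
    k<σ {j} = subst (j <_) (sym (length-IsPerm σ-perm))
    compare : Dec (suc k ≡ τ ! k) → Dec (suc (suc k) ≡ τ ! suc k) →
      (zEntry (suc (suc k) , τ ! suc k) <ᵇ zEntry (suc k , τ ! k)) ≡ (posOf (suc (suc k)) σ <ᵇ posOf (suc k) σ)
    compare (yes i-fixed) (yes i+1-fixed) =
      trans (cong₂ _<ᵇ_ (if-≡ᵇ-yes 0 _ i+1-fixed) (if-≡ᵇ-yes 0 _ i-fixed))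
        (sym (<ᵇ-false (<⇒≤ (fixed-before-fixed (fixed∈FIX k<n i-fixed) (fixed∈FIX k+1<n i+1-fixed) ≤-refl))))
    compare (yes i-fixed) (no i+1-moved) =
      trans (cong₂ _<ᵇ_ (if-≡ᵇ-no 0 _ i+1-moved) (if-≡ᵇ-yes 0 _ i-fixed))
        (trans (<ᵇ-false {red (NF τ) (τ ! suc k)} z≤n)
          (sym (<ᵇ-false (<⇒≤ (fixed-before-moved (fixed∈FIX k<n i-fixed)
            (∈-map⁺ proj₁ (moved∈movedPairs k+1<n i+1-moved)) (moved∉FIX i+1-moved))))))
    compare (no i-moved) (yes i+1-fixed) =
      trans (cong₂ _<ᵇ_ (if-≡ᵇ-yes 0 _ i+1-fixed) (if-≡ᵇ-no 0 _ i-moved))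
        (trans (<ᵇ-true (red-positive (NF τ) (τ ! k) (moved-value∈NF (moved∈movedPairs k<n i-moved))))
          (sym (<ᵇ-true (fixed-before-moved (fixed∈FIX k+1<n i+1-fixed)
            (∈-map⁺ proj₁ (moved∈movedPairs k<n i-moved)) (moved∉FIX i-moved)))))
    compare (no i-moved) (no i+1-moved) =
      trans (cong₂ _<ᵇ_ (if-≡ᵇ-no 0 _ i+1-moved) (if-≡ᵇ-no 0 _ i-moved)) (moved-moved k+1<n i-moved i+1-moved)

  DEZ≡IDES : DEZ τ ≡ IDES σ
  DEZ≡IDES = DESfrom-cong 1 (ZDer τ) (inv σ) (trans length-ZDer (sym length-inv-σ))
    (λ k k+1< → descentAt-ZDer≡descentAt-inv k (subst (suc k <_) length-ZDer k+1<))
    where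
    length-ZDer : length (ZDer τ) ≡ n
    length-ZDer = trans (length-map zEntry (enum τ)) (trans (length-enum τ) length-τ)
    length-inv-σ : length (inv σ) ≡ n
    length-inv-σ = trans (length-inv σ) (length-IsPerm σ-perm)

++-injectiveˡ : (xs ys xs′ ys′ : Word) → length xs ≡ length xs′ → xs ++ ys ≡ xs′ ++ ys′ → xs ≡ xs′ × ys ≡ ys′
++-injectiveˡ []       ys []         ys′ _  eq = refl , eq
++-injectiveˡ (x ∷ xs) ys (x′ ∷ xs′) ys′ eqˡ eq
  with refl , eq′ ← ∷-injective eq
  with refl , refl ← ++-injectiveˡ xs ys xs′ ys′ (suc-injective eqˡ) eq′ = refl , refl

++-injectiveʳ : (xs ys xs′ ys′ : Word) → length ys ≡ length ys′ → xs ++ ys ≡ xs′ ++ ys′ → xs ≡ xs′ × ys ≡ ys′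
++-injectiveʳ xs ys xs′ ys′ eqʳ eq = ++-injectiveˡ xs ys xs′ ys′ (+-cancelʳ-≡ (length ys) _ _ (begin
  length xs + length ys    ≡⟨ length-++ xs ⟨
  length (xs ++ ys)        ≡⟨ cong length eq ⟩
  length (xs′ ++ ys′)      ≡⟨ length-++ xs′ ⟩
  length xs′ + length ys′  ≡⟨ cong (length xs′ +_) eqʳ ⟨
  length xs′ + length ys   ∎)) eq
  where open ≡-Reasoning

IsPixFactor-unique : ∀ {σ p d p′ d′} → IsPixFactor σ p d → IsPixFactor σ p′ d′ → p ≡ p′ × d ≡ d′
IsPixFactor-unique {p = p} {d} {p′} {d′} (factor , longest) (factor′ , longest′) =
  ++-injectiveʳ p d p′ d′ (≤-antisym (longest′ p d factor) (longest p′ d′ factor′))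
    (trans (sym (proj₁ factor)) (proj₁ factor′))

proposition2p3 : (DW : ℕ → Word → Word) → IsDW DW →
    (n : ℕ) (τ σ : Word) → IsPerm n τ → IsPerm n σ → IsDWloc DW τ σ →
    (p d : Word) → IsPixFactor σ p d →
      ((FIX τ ≡ p) × (DEZ τ ≡ IDES σ)) × ((fix τ ≡ length p) × (maz τ ≡ imaj σ))
proposition2p3 DW (DW-spec , _) n τ σ τ-perm σ-perm (p₀ , d₀ , pix₀ , p₀≡FIX , std≡DW) p d pix =
  (FIX≡p , DEZ≡IDES) , (cong length FIX≡p , cong sum DEZ≡IDES)
  where
  FIX≡p : FIX τ ≡ p
  FIX≡p = trans (sym p₀≡FIX) (proj₁ (IsPixFactor-unique pix₀ pix))
  open DWloc DW (λ m δ δ-der → proj₂ (DW-spec m δ δ-der)) τ σ d₀ τ-perm σ-perm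
    (trans (proj₁ (proj₁ pix₀)) (cong (_++ d₀) p₀≡FIX)) std≡DW
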